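{- Let $G$ be a finite abelian group of order $n\geq 10^{100}$ and let $k$ be a positive integer. Let $S\subseteq (G\ast F_k)^{\mathrm{ab}}$ be a set of size at most $1000$. Then there are at most $|S|^2n^{k-1/5}$ projections $\pi\colon (G\ast F_k)^{\mathrm{ab}}\to G$ which do not separate $S$.
   Context: $F_k$ is the free abelian group on free variables $v_1,\dots,v_k$; $(G\ast F_k)^{\mathrm{ab}}$ is the abelianization of the free product (isomorphic to $G\times F_k$), whose elements are uniquely $z_1v_1+\dots+z_kv_k+g$ ($z_i\in\mathbb{Z}$, $g\in G$). A word is linear in $v_i$ if its coefficient of $v_i$ is $\pm1$. A projection is a homomorphism $\pi\colon (G\ast F_k)^{\mathrm{ab}}\to G$ with $\pi(g)=g$ for $g\in G$. Two elements $w,w'$ are separable if (a) $w'-w$ is linear in some free variable; or (b) $w-w'=g$ for some non-zero $g\in G$; or (c) $w-w'=\pm(3v_i-2v_j)+h$ for some $h\in G$ and distinct free variables $v_i,v_j$. A homomorphism $\phi\colon (G\ast F_k)^{\mathrm{ab}}\to G$ separates a set $S$ if $\phi(w)\neq\phi(w')$ for every separable pair $w,w'\in S$. -}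

module Defs where

open import Level using (Level; _⊔_)
open import Algebra.Bundles using (AbelianGroup)
open import Data.Nat using (ℕ)
open import Data.Fin using (Fin)
open import Data.Integer as ℤ using (ℤ; +_; -[1+_])
open import Data.Product using (Σ; ∃; ∃-syntax; _×_; _,_; proj₁; proj₂)
open import Data.Sum using (_⊎_)
open import Relation.Binary.PropositionalEquality using (_≡_)
open import Relation.Nullary using (¬_; does)
open import Data.Bool using (if_then_else_)
open import Data.List using (List)
open import Data.List.Membership.Propositional using (_∈_)
open import Level using (Lift)
import Data.Fin as F

coef32 : ∀ {k} → Fin k → Fin k → Fin k → ℤ
coef32 i j l = if does (l F.≟ i) then + 3 else (if does (l F.≟ j) then -[1+ 1 ] else + 0)


module _ {c ℓ : Level} (G : AbelianGroup c ℓ) where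
  open AbelianGroup G

  record HasOrder (n : ℕ) : Set (c ⊔ ℓ) where
    field
      enum       : Fin n → Carrier
      enum-inj   : ∀ i j → enum i ≈ enum j → i ≡ j
      enum-surj  : ∀ g → ∃[ i ] enum i ≈ g

  -- Elements of (G * F_k)^ab ≅ ℤ^k × G, written z₁v₁+…+z_kv_k+g.
  Word : ℕ → Set c
  Word k = (Fin k → ℤ) × Carrier

  _≈W_ : ∀ {k} → Word k → Word k → Set ℓ
  (z , g) ≈W (z' , g') = (∀ i → z i ≡ z' i) × (g ≈ g')

  _+W_ : ∀ {k} → Word k → Word k → Word k
  (z , g) +W (z' , g') = (λ i → z i ℤ.+ z' i) , (g ∙ g')

  ι : ∀ {k} → Carrier → Word k
  ι g = (λ _ → + 0) , g

  record Projection (k : ℕ) : Set (c ⊔ ℓ) where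
    field
      π        : Word k → Carrier
      π-cong   : ∀ {w w'} → w ≈W w' → π w ≈ π w'
      π-hom    : ∀ w w' → π (w +W w') ≈ (π w ∙ π w')
      π-fix    : ∀ g → π (ι g) ≈ g
  open Projection public

  Distinct : ∀ {k} → Projection k → Projection k → Set (c ⊔ ℓ)
  Distinct p q = ∃[ w ] ¬ (π p w ≈ π q w)

  LinearDiff : ∀ {k} → Word k → Word k → Set
  LinearDiff {k} (z , _) (z' , _) =
    ∃[ i ] ((z' i ℤ.- z i ≡ + 1) ⊎ (z' i ℤ.- z i ≡ -[1+ 0 ]))

  GroupDiff : ∀ {k} → Word k → Word k → Set ℓ
  GroupDiff (z , g) (z' , g') = (∀ i → z i ≡ z' i) × ¬ ((g ∙ (g' ⁻¹)) ≈ ε)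

  ThreeTwoDiff : ∀ {k} → Word k → Word k → Set
  ThreeTwoDiff {k} (z , _) (z' , _) =
    ∃[ i ] ∃[ j ] ¬ (i ≡ j) × ∃[ s ] ((s ≡ + 1) ⊎ (s ≡ -[1+ 0 ])) ×
      (∀ l → z l ℤ.- z' l ≡ s ℤ.* coef32 i j l)

  Separable : ∀ {k} → Word k → Word k → Set ℓ
  Separable w w' = Lift ℓ (LinearDiff w w') ⊎ GroupDiff w w' ⊎ Lift ℓ (ThreeTwoDiff w w')

  Separates : ∀ {k} → (Word k → Carrier) → List (Word k) → Set (c ⊔ ℓ)
  Separates φ S = ∀ w w' → w ∈ S → w' ∈ S → Separable w w' → ¬ (φ w ≈ φ w')

-- A projection π is determined by the homomorphism v ↦ π(v) on the free part ℤ^k, i.e. by its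
-- values on the basis vectors e_l.  If π does not separate S, it identifies a separable pair
-- w, w' ∈ S.  A pair of type (b) is identified by no projection.  For types (a) and (c) there
-- are k − 1 vectors (a frame) which together with w' − w generate ℤ^k: the e_l for l ≠ i when
-- w' − w has coefficient ±1 at v_i, and the e_l for l ∉ {i, j} together with e_i − e_j when
-- w − w' = ±(3e_i − 2e_j), since 3e_i − 2e_j − 3(e_i − e_j) = e_j.  Two projections identifying
-- the pair agree on w' − w, so if they also agree on the frame they coincide.  Hence a
-- non-separating projection is determined by the pair and k − 1 elements of G, giving at most
-- |S|² n^(k−1) ≤ |S|² n^(k−1/5) of them; of the size hypotheses only n ≥ 1 is needed.

module Submission where

open import Defs
open import Level using (Level)
open import Algebra.Bundles using (AbelianGroup)
open import Data.Nat using (ℕ; _≤_; _^_; _*_; _∸_)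
open import Data.List using (List; length)
open import Data.List.Relation.Unary.All using (All)
open import Data.List.Relation.Unary.AllPairs using (AllPairs)
open import Relation.Nullary using (¬_)

open import Level using (_⊔_; lift) renaming (suc to lsuc)
open import Data.Nat using (zero; suc; _+_; s≤s)
import Data.Nat.Properties as ℕP
open import Data.Nat.Solver using (module +-*-Solver)
open import Data.Integer as ℤ using (ℤ; +_; -[1+_]; 0ℤ; 1ℤ; -1ℤ)
import Data.Integer.Properties as ℤP
open import Data.Integer.Tactic.RingSolver using (solve-∀)
open import Data.Fin as F using (Fin; zero; suc; punchIn; punchOut; combine; funToFin; finToFun)
import Data.Fin.Properties as FP
import Data.Vec.Functional as Vector
open import Data.List using (lookup)
import Data.List.Relation.Unary.All as All
open import Data.List.Relation.Unary.AllPairs using (_∷_)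
open import Data.List.Relation.Unary.Any using (index)
open import Data.List.Relation.Unary.Any.Properties using (lookup-index)
open import Data.List.Membership.Propositional.Properties using (∈-lookup)
open import Data.Maybe using (Maybe; just; nothing; Is-just; to-witness)
import Data.Maybe.Relation.Unary.Any as Maybe
open import Data.Product using (_×_; _,_; proj₁; proj₂)
open import Data.Sum using (_⊎_; inj₁; inj₂; map₂)
open import Data.Bool using (if_then_else_)
open import Data.Unit using (tt)
open import Data.Unit.Properties using (⊤-irrelevant)
open import Data.Empty using (⊥-elim)
open import Function using (_∘_; case_of_)
open import Relation.Binary.Definitions using (tri<; tri≈; tri>)
open import Relation.Nullary using (Dec; does; yes; no)
open import Relation.Nullary.Decidable using (dec-true; dec-false; map′; ¬?; _×-dec_; _⊎-dec_)
open import Relation.Binary.PropositionalEquality as ≡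
  using (_≡_; _≢_; _≗_; refl; cong; subst; subst₂)

ℤ^_ : ℕ → Set
ℤ^ k = Fin k → ℤ

module _ {k : ℕ} where

  infixl 6 _+ᵛ_ _-ᵛ_
  infixl 7 _·ᵛ_
  infix 8 -ᵛ_

  0ᵛ : ℤ^ k
  0ᵛ _ = 0ℤ

  _+ᵛ_ : ℤ^ k → ℤ^ k → ℤ^ k
  (u +ᵛ v) l = u l ℤ.+ v l

  -ᵛ_ : ℤ^ k → ℤ^ k
  (-ᵛ u) l = ℤ.- u l

  _-ᵛ_ : ℤ^ k → ℤ^ k → ℤ^ k
  u -ᵛ v = u +ᵛ (-ᵛ v)

  _·ᵛ_ : ℤ → ℤ^ k → ℤ^ k
  (s ·ᵛ u) l = s ℤ.* u l

  e : Fin k → ℤ^ k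
  e i l = if does (l F.≟ i) then 1ℤ else 0ℤ

  e-diag : ∀ i → e i i ≡ 1ℤ
  e-diag i rewrite dec-true (i F.≟ i) refl = refl

Unit : ℤ → Set
Unit s = s ≡ 1ℤ ⊎ s ≡ -1ℤ

unit-square : ∀ {s} → Unit s → ∀ x → s ℤ.* (s ℤ.* x) ≡ x
unit-square (inj₁ refl) x = ≡.trans (≡.sym (ℤP.*-assoc 1ℤ 1ℤ x)) (ℤP.*-identityˡ x)
unit-square (inj₂ refl) x = ≡.trans (≡.sym (ℤP.*-assoc -1ℤ -1ℤ x)) (ℤP.*-identityˡ x)

[a+b]-a≡b : ∀ a b → a ℤ.+ b ℤ.- a ≡ b
[a+b]-a≡b = solve-∀

[a-b]+b≡a : ∀ a b → a ℤ.- b ℤ.+ b ≡ a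
[a-b]+b≡a = solve-∀

a+[b-a]≡b : ∀ a b → a ℤ.+ (b ℤ.- a) ≡ b
a+[b-a]≡b = solve-∀

record Subgroup ℓ (k : ℕ) : Set (lsuc ℓ) where
  field
    Member      : ℤ^ k → Set ℓ
    member-resp : ∀ {u v} → u ≗ v → Member u → Member v
    0-member    : Member 0ᵛ
    +-member    : ∀ {u v} → Member u → Member v → Member (u +ᵛ v)
    neg-member  : ∀ {u} → Member u → Member (-ᵛ u)

  cancel-member : ∀ {u v} → Member (u +ᵛ v) → Member u → Member v
  cancel-member {u} {v} u+v∈ u∈ =
    member-resp (λ l → [a+b]-a≡b (u l) (v l)) (+-member u+v∈ (neg-member u∈))

  ℕ·-member : ∀ n {u} → Member u → Member (+ n ·ᵛ u)
  ℕ·-member zero    {u} _  = member-resp (λ l → ≡.sym (ℤP.*-zeroˡ (u l))) 0-member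
  ℕ·-member (suc n) {u} u∈ =
    member-resp (λ l → ≡.sym (ℤP.suc-* (+ n) (u l))) (+-member u∈ (ℕ·-member n u∈))

  ·-member : ∀ s {u} → Member u → Member (s ·ᵛ u)
  ·-member (+ n)        u∈ = ℕ·-member n u∈
  ·-member -[1+ n ] {u} u∈ =
    member-resp (λ l → ℤP.neg-distribˡ-* (+ suc n) (u l)) (neg-member (ℕ·-member (suc n) u∈))

  unit-·-member⁻¹ : ∀ {s u} → Unit s → Member (s ·ᵛ u) → Member u
  unit-·-member⁻¹ {s} {u} unit su∈ = member-resp (unit-square unit ∘ u) (·-member s su∈)

open Subgroup

restrict : ∀ {ℓ k} → Subgroup ℓ (suc k) → Subgroup ℓ k
restrict H = record
  { Member      = λ v → Member H (0ℤ Vector.∷ v)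
  ; member-resp = λ u≗v → member-resp H λ { zero → refl ; (suc l) → u≗v l }
  ; 0-member    = member-resp H (λ { zero → refl ; (suc l) → refl }) (0-member H)
  ; +-member    = λ u∈ v∈ → member-resp H (λ { zero → refl ; (suc l) → refl }) (+-member H u∈ v∈)
  ; neg-member  = λ u∈ → member-resp H (λ { zero → refl ; (suc l) → refl }) (neg-member H u∈)
  }

member-from-support : ∀ {ℓ k} (H : Subgroup ℓ k) {v} →
                      (∀ l → v l ≡ 0ℤ ⊎ Member H (e l)) → Member H v
member-from-support {k = zero}  H _ = member-resp H (λ ()) (0-member H)
member-from-support {k = suc k} H {v} support = member-resp H split (+-member H head∈ tail∈)
  where
  head∈ : Member H (v zero ·ᵛ e zero)
  head∈ with support zero
  ... | inj₁ v₀≡0 = member-resp H (λ l → ≡.sym (cong (ℤ._* e zero l) v₀≡0)) (0-member H)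
  ... | inj₂ e₀∈  = ·-member H (v zero) e₀∈
  tail∈ : Member H (0ℤ Vector.∷ Vector.tail v)
  tail∈ = member-from-support (restrict H) λ l →
    map₂ (member-resp H λ { zero → refl ; (suc m) → refl }) (support (suc l))
  split : v zero ·ᵛ e zero +ᵛ (0ℤ Vector.∷ Vector.tail v) ≗ v
  split zero    = ≡.trans (ℤP.+-identityʳ _) (ℤP.*-identityʳ (v zero))
  split (suc l) = ≡.trans (cong (ℤ._+ v (suc l)) (ℤP.*-zeroʳ (v zero))) (ℤP.+-identityˡ (v (suc l)))

module _ {ℓ k} (H : Subgroup ℓ k) where

  complete-basis : ∀ {i} → (∀ l → l ≢ i → Member H (e l)) → Member H (e i) → ∀ l → Member H (e l)
  complete-basis {i} others eᵢ∈ l with l F.≟ i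
  ... | yes refl = eᵢ∈
  ... | no l≢i   = others l l≢i

  basis-from-unit-coordinate : ∀ {i v} → (∀ l → l ≢ i → Member H (e l)) → Member H v →
                               Unit (v i) → ∀ l → Member H (e l)
  basis-from-unit-coordinate {i} {v} others v∈ unit =
    complete-basis others (unit-·-member⁻¹ H unit vᵢeᵢ∈)
    where
    r∈ : Member H (v -ᵛ v i ·ᵛ e i)
    r∈ = member-from-support H λ l → case l F.≟ i of λ where
      (yes refl) → inj₁ (≡.trans (cong (λ x → v i ℤ.- v i ℤ.* x) (e-diag i))
                                 (≡.trans (cong (λ x → v i ℤ.- x) (ℤP.*-identityʳ (v i)))
                                          (ℤP.+-inverseʳ (v i))))
      (no l≢i)   → inj₂ (others l l≢i)
    vᵢeᵢ∈ : Member H (v i ·ᵛ e i)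
    vᵢeᵢ∈ = cancel-member H (member-resp H (λ l → ≡.sym ([a-b]+b≡a (v l) _)) v∈) r∈

module Projections {c ℓ : Level} (G : AbelianGroup c ℓ) where
  open AbelianGroup G renaming (refl to ≈-refl)
  open import Algebra.Properties.AbelianGroup G
    using (∙-cancelˡ; ∙-cancelʳ; inverseʳ-unique; x≈y⇒x∙y⁻¹≈ε)
  open import Relation.Binary.Reasoning.Setoid setoid

  module _ {k} (p : Projection G k) where

    πᶻ : ℤ^ k → Carrier
    πᶻ z = π p (z , ε)

    πᶻ-cong : ∀ {u v} → u ≗ v → πᶻ u ≈ πᶻ v
    πᶻ-cong u≗v = π-cong p (u≗v , ≈-refl)

    πᶻ-0 : πᶻ 0ᵛ ≈ ε
    πᶻ-0 = π-fix p ε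

    πᶻ-+ : ∀ u v → πᶻ (u +ᵛ v) ≈ πᶻ u ∙ πᶻ v
    πᶻ-+ u v = trans (π-cong p ((λ _ → refl) , sym (identityʳ ε))) (π-hom p (u , ε) (v , ε))

    πᶻ-neg : ∀ u → πᶻ (-ᵛ u) ≈ πᶻ u ⁻¹
    πᶻ-neg u = inverseʳ-unique (πᶻ u) (πᶻ (-ᵛ u)) (begin
      πᶻ u ∙ πᶻ (-ᵛ u) ≈⟨ πᶻ-+ u (-ᵛ u) ⟨
      πᶻ (u -ᵛ u)      ≈⟨ πᶻ-cong (ℤP.+-inverseʳ ∘ u) ⟩
      πᶻ 0ᵛ            ≈⟨ πᶻ-0 ⟩
      ε                ∎)

    π-split : ∀ z g → π p (z , g) ≈ πᶻ z ∙ g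
    π-split z g = begin
      π p (z , g)                  ≈⟨ π-cong p (≡.sym ∘ ℤP.+-identityʳ ∘ z , sym (identityˡ g)) ⟩
      π p (_+W_ G (z , ε) (ι G g)) ≈⟨ π-hom p (z , ε) (ι G g) ⟩
      πᶻ z ∙ π p (ι G g)           ≈⟨ ∙-congˡ (π-fix p g) ⟩
      πᶻ z ∙ g                     ∎

    identified-shift : ∀ {z g z' g'} → π p (z , g) ≈ π p (z' , g') → g ≈ πᶻ (z' -ᵛ z) ∙ g'
    identified-shift {z} {g} {z'} {g'} h = ∙-cancelˡ (πᶻ z) g _ (begin
      πᶻ z ∙ g                   ≈⟨ π-split z g ⟨
      π p (z , g)                ≈⟨ h ⟩
      π p (z' , g')              ≈⟨ π-split z' g' ⟩
      πᶻ z' ∙ g'                 ≈⟨ ∙-congʳ (πᶻ-cong (λ i → a+[b-a]≡b (z i) (z' i))) ⟨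
      πᶻ (z +ᵛ (z' -ᵛ z)) ∙ g'   ≈⟨ ∙-congʳ (πᶻ-+ z (z' -ᵛ z)) ⟩
      (πᶻ z ∙ πᶻ (z' -ᵛ z)) ∙ g' ≈⟨ assoc _ _ _ ⟩
      πᶻ z ∙ (πᶻ (z' -ᵛ z) ∙ g') ∎)

  Identifies : ∀ {k} → Projection G k → Word G k → Word G k → Set ℓ
  Identifies p w w' = π p w ≈ π p w'

  Agree : ∀ {k} → Projection G k → Projection G k → ℤ^ k → Set ℓ
  Agree p q v = πᶻ p v ≈ πᶻ q v

  agreement : ∀ {k} (p q : Projection G k) → Subgroup ℓ k
  agreement p q = record
    { Member      = Agree p q
    ; member-resp = λ u≗v pu≈qu → trans (πᶻ-cong p (≡.sym ∘ u≗v)) (trans pu≈qu (πᶻ-cong q u≗v))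
    ; 0-member    = trans (πᶻ-0 p) (sym (πᶻ-0 q))
    ; +-member    = λ {u} {v} pu≈qu pv≈qv →
        trans (πᶻ-+ p u v) (trans (∙-cong pu≈qu pv≈qv) (sym (πᶻ-+ q u v)))
    ; neg-member  = λ {u} pu≈qu → trans (πᶻ-neg p u) (trans (⁻¹-cong pu≈qu) (sym (πᶻ-neg q u)))
    }

  module _ {k} (p q : Projection G k) where

    agree-on-difference : ∀ w w' → Identifies p w w' → Identifies q w w' →
                          Agree p q (proj₁ w' -ᵛ proj₁ w)
    agree-on-difference _ (_ , g') p-id q-id =
      ∙-cancelʳ g' _ _ (trans (sym (identified-shift p p-id)) (identified-shift q q-id))

    agree-on-basis⇒agree : (∀ l → Agree p q (e l)) → ∀ w → π p w ≈ π q w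
    agree-on-basis⇒agree basis (z , g) = begin
      π p (z , g) ≈⟨ π-split p z g ⟩
      πᶻ p z ∙ g  ≈⟨ ∙-congʳ (member-from-support (agreement p q) (inj₂ ∘ basis)) ⟩
      πᶻ q z ∙ g  ≈⟨ π-split q z g ⟨
      π q (z , g) ∎

  group-difference-unidentifiable : ∀ {k} (p : Projection G k) {w w'} →
                                    GroupDiff G w w' → ¬ Identifies p w w'
  group-difference-unidentifiable p {z , g} {z' , g'} (z≗z' , g≉g') p-id =
    g≉g' (x≈y⇒x∙y⁻¹≈ε (begin
      g                   ≈⟨ identified-shift p p-id ⟩
      πᶻ p (z' -ᵛ z) ∙ g' ≈⟨ ∙-congʳ (πᶻ-cong p (λ i → ℤP.i≡j⇒i-j≡0 (≡.sym (z≗z' i)))) ⟩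
      πᶻ p 0ᵛ ∙ g'        ≈⟨ ∙-congʳ (πᶻ-0 p) ⟩
      ε ∙ g'              ≈⟨ identityˡ g' ⟩
      g'                  ∎))

∀punchIn⇒∀≢ : ∀ {a k} {Q : Fin (suc k) → Set a} i → (∀ m → Q (punchIn i m)) → ∀ l → l ≢ i → Q l
∀punchIn⇒∀≢ {Q = Q} i h l l≢i =
  subst Q (FP.punchIn-punchOut (l≢i ∘ ≡.sym)) (h (punchOut (l≢i ∘ ≡.sym)))

coef32-decomposition : ∀ {k} {i j : Fin k} → i ≢ j →
                       ∀ l → coef32 i j l ℤ.- + 3 ℤ.* (e i l ℤ.- e j l) ≡ e j l
coef32-decomposition {i = i} {j} i≢j l with l F.≟ i | l F.≟ j
... | yes refl | yes refl = ⊥-elim (i≢j refl)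
... | yes _    | no _     = refl
... | no _     | yes _    = refl
... | no _     | no _     = refl

module Frames {c ℓ : Level} (G : AbelianGroup c ℓ) where
  open AbelianGroup G using (_≈_; sym)
  open Projections G

  record Frame {k} (w w' : Word G (suc k)) : Set (c ⊔ ℓ) where
    field
      vectors    : Fin k → ℤ^ suc k
      determines : ∀ p q → Identifies p w w' → Identifies q w w' →
                   (∀ m → Agree p q (vectors m)) → ∀ x → π p x ≈ π q x

  module _ {k} (w w' : Word G (suc k)) where

    linear-frame : LinearDiff G w w' → Frame w w'
    linear-frame (i , unit) = record
      { vectors    = e ∘ punchIn i
      ; determines = λ p q p-id q-id agree-vectors → agree-on-basis⇒agree p q
          (basis-from-unit-coordinate (agreement p q) (∀punchIn⇒∀≢ i agree-vectors)
                                      (agree-on-difference p q w w' p-id q-id) unit)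
      }

    three-two-frame : ThreeTwoDiff G w w' → Frame w w'
    three-two-frame (i , j , i≢j , s , unit , w-w'≗s·c) = record
      { vectors    = B ∘ punchIn j
      ; determines = determines
      }
      where
      B : Fin (suc k) → ℤ^ suc k
      B l = if does (l F.≟ i) then e i -ᵛ e j else e l

      B-diag : B i ≡ e i -ᵛ e j
      B-diag rewrite dec-true (i F.≟ i) refl = refl

      B-off : ∀ {l} → l ≢ i → B l ≡ e l
      B-off {l} l≢i rewrite dec-false (l F.≟ i) l≢i = refl

      determines : ∀ p q → Identifies p w w' → Identifies q w w' →
                   (∀ m → Agree p q (B (punchIn j m))) → ∀ x → π p x ≈ π q x
      determines p q p-id q-id agree-B = agree-on-basis⇒agree p q (complete-basis H others eⱼ∈)
        where
        H = agreement p q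
        B∈ : ∀ l → l ≢ j → Member H (B l)
        B∈ = ∀punchIn⇒∀≢ j agree-B
        eᵢ-eⱼ∈ : Member H (e i -ᵛ e j)
        eᵢ-eⱼ∈ = subst (Member H) B-diag (B∈ i i≢j)
        c∈ : Member H (coef32 i j)
        c∈ = unit-·-member⁻¹ H unit
               (member-resp H w-w'≗s·c (agree-on-difference p q w' w (sym p-id) (sym q-id)))
        eⱼ∈ : Member H (e j)
        eⱼ∈ = member-resp H (coef32-decomposition i≢j)
                (+-member H c∈ (neg-member H (·-member H (+ 3) eᵢ-eⱼ∈)))
        eᵢ∈ : Member H (e i)
        eᵢ∈ = member-resp H (λ l → [a-b]+b≡a (e i l) (e j l)) (+-member H eᵢ-eⱼ∈ eⱼ∈)
        others : ∀ l → l ≢ j → Member H (e l)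
        others l l≢j with l F.≟ i
        ... | yes refl = eᵢ∈
        ... | no l≢i   = subst (Member H) (B-off l≢i) (B∈ l l≢j)

    LinearDiff? : Dec (LinearDiff G w w')
    LinearDiff? = FP.any? λ i → (d i ℤ.≟ 1ℤ) ⊎-dec (d i ℤ.≟ -1ℤ)
      where d = proj₁ w' -ᵛ proj₁ w

    ThreeTwoDiff? : Dec (ThreeTwoDiff G w w')
    ThreeTwoDiff? = FP.any? λ i → FP.any? λ j → ¬? (i F.≟ j) ×-dec signed? i j
      where
      fits? : ∀ i j s → Dec (∀ l → proj₁ w l ℤ.- proj₁ w' l ≡ s ℤ.* coef32 i j l)
      fits? i j s = FP.all? λ l → (proj₁ w l ℤ.- proj₁ w' l) ℤ.≟ s ℤ.* coef32 i j l
      signed? = λ i j → map′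
        (λ { (inj₁ f) → 1ℤ , inj₁ refl , f ; (inj₂ f) → -1ℤ , inj₂ refl , f })
        (λ { (_ , inj₁ refl , f) → inj₁ f ; (_ , inj₂ refl , f) → inj₂ f })
        (fits? i j 1ℤ ⊎-dec fits? i j -1ℤ)

    -- Only frame?-complete is ever needed about frame?; keeping it opaque stops the
    -- unifier from unfolding the decision procedures in the types of Counting.
    opaque
      frame? : Maybe (Frame w w')
      frame? with LinearDiff? | ThreeTwoDiff?
      ... | yes lin | _       = just (linear-frame lin)
      ... | no _    | yes t32 = just (three-two-frame t32)
      ... | no _    | no _    = nothing

      frame?-complete : ∀ p → Separable G w w' → Identifies p w w' → Is-just frame?
      frame?-complete p sep p-id with LinearDiff? | ThreeTwoDiff?
      ... | yes _   | _     = Maybe.just _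
      ... | no _    | yes _ = Maybe.just _
      ... | no ¬lin | no ¬t32 with sep
      ...   | inj₁ (lift lin)        = ⊥-elim (¬lin lin)
      ...   | inj₂ (inj₁ gd)         = ⊥-elim (group-difference-unidentifiable p gd p-id)
      ...   | inj₂ (inj₂ (lift t32)) = ⊥-elim (¬t32 t32)

funToFin-injective : ∀ {k n} {f g : Fin k → Fin n} → funToFin f ≡ funToFin g → f ≗ g
funToFin-injective {f = f} {g} eq j = begin
  f j                     ≡⟨ FP.finToFun-funToFin f j ⟨
  finToFun (funToFin f) j ≡⟨ cong (λ t → finToFun t j) eq ⟩
  finToFun (funToFin g) j ≡⟨ FP.finToFun-funToFin g j ⟩
  g j                     ∎
  where open ≡.≡-Reasoning

module _ {a r} {A : Set a} {R : A → A → Set r} where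

  AllPairs-lookup : ∀ {xs} → AllPairs R xs → ∀ {i j} → i F.< j → R (lookup xs i) (lookup xs j)
  AllPairs-lookup (Rx ∷ _)  {zero}  {suc j} _         = All.lookup Rx (∈-lookup j)
  AllPairs-lookup (_ ∷ Rxs) {suc i} {suc j} (s≤s i<j) = AllPairs-lookup Rxs i<j

  length≤-by-code : ∀ {p N} {P : A → Set p} (code : ∀ {x} → P x → Fin N) →
                    (∀ {x y} (px : P x) (py : P y) → R x y → code px ≢ code py) →
                    ∀ {xs} → AllPairs R xs → All P xs → length xs ≤ N
  length≤-by-code code separated {xs} Rxs Pxs = FP.injective⇒≤ injective
    where
    code-at : Fin (length xs) → Fin _
    code-at i = code (All.lookup Pxs (∈-lookup i))
    injective : ∀ {i j} → code-at i ≡ code-at j → i ≡ j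
    injective {i} {j} eq with FP.<-cmp i j
    ... | tri< i<j _ _ = ⊥-elim (separated _ _ (AllPairs-lookup Rxs i<j) eq)
    ... | tri≈ _ i≡j _ = i≡j
    ... | tri> _ _ j<i = ⊥-elim (separated _ _ (AllPairs-lookup Rxs j<i) (≡.sym eq))

module Counting {c ℓ : Level} (G : AbelianGroup c ℓ) {n} (order : HasOrder G n)
                {k} (S : List (Word G (suc k))) where
  open AbelianGroup G using (Carrier; _≈_; sym; trans; reflexive)
  open HasOrder order
  open Projections G
  open Frames G
  open Frame

  index-of : Carrier → Fin n
  index-of g = proj₁ (enum-surj g)

  index-of-injective : ∀ {g h} → index-of g ≡ index-of h → g ≈ h
  index-of-injective {g} {h} eq =
    trans (sym (proj₂ (enum-surj g))) (trans (reflexive (cong enum eq)) (proj₂ (enum-surj h)))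

  _≈?_ : ∀ g h → Dec (g ≈ h)
  g ≈? h with index-of g F.≟ index-of h
  ... | yes eq = yes (index-of-injective eq)
  ... | no neq = no λ g≈h → neq (enum-inj _ _
                   (trans (proj₂ (enum-surj g)) (trans g≈h (sym (proj₂ (enum-surj h))))))

  record Catch (p : Projection G (suc k)) : Set (c ⊔ ℓ) where
    constructor caught
    field
      left right : Fin (length S)
      framed     : Is-just (frame? (lookup S left) (lookup S right))
      identified : Identifies p (lookup S left) (lookup S right)

  catch : ∀ p → ¬ Separates G (π p) S → Catch p
  catch p ¬separates with FP.any? (λ a → FP.any? (caught? a))
    where
    caught? : ∀ a b → Dec (Is-just (frame? (lookup S a) (lookup S b)) ×
                           Identifies p (lookup S a) (lookup S b))
    caught? a b = Maybe.dec (λ _ → yes tt) (frame? (lookup S a) (lookup S b))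
                  ×-dec (π p (lookup S a) ≈? π p (lookup S b))
  ... | yes (a , b , framed , identified) = caught a b framed identified
  ... | no ¬caught = ⊥-elim (¬separates separates)
    where
    separates : Separates G (π p) S
    separates w w' w∈S w'∈S sep p-id = ¬caught (index w∈S , index w'∈S ,
      subst₂ (λ x y → Is-just (frame? x y) × Identifies p x y)
             (lookup-index w∈S) (lookup-index w'∈S) (frame?-complete w w' p sep p-id , p-id))

  code : ∀ {p} → Catch p → Fin (length S * (length S * n ^ k))
  code {p} (caught a b framed _) =
    combine a (combine b (funToFin (index-of ∘ πᶻ p ∘ vectors (to-witness framed))))

  code-determines : ∀ {p q} (x : Catch p) (y : Catch q) → code x ≡ code y → ∀ w → π p w ≈ π q w
  code-determines {p} {q} (caught a b fx p-id) (caught a′ b′ fy q-id) eq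
    with FP.combine-injective a _ a′ _ eq
  ... | refl , eq′ with FP.combine-injective b _ b′ _ eq′
  ... | refl , eq″ with Maybe.irrelevant ⊤-irrelevant fx fy
  ... | refl =
    determines (to-witness fx) p q p-id q-id (index-of-injective ∘ funToFin-injective eq″)

fifth-power-bound : ∀ L m n k → 1 ≤ n → L ≤ m * (m * n ^ k) → L ^ 5 ≤ m ^ 10 * n ^ (5 * suc k ∸ 1)
fifth-power-bound L m n@(suc _) k _ L≤ = begin
  L ^ 5                        ≤⟨ ℕP.^-monoˡ-≤ 5 L≤ ⟩
  (m * (m * n ^ k)) ^ 5        ≡⟨ regroup m (n ^ k) ⟩
  m ^ 10 * (n ^ k) ^ 5         ≡⟨ cong (m ^ 10 *_) (ℕP.^-*-assoc n k 5) ⟩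
  m ^ 10 * n ^ (k * 5)         ≤⟨ ℕP.*-monoʳ-≤ (m ^ 10) (ℕP.^-monoʳ-≤ n exponent) ⟩
  m ^ 10 * n ^ (5 * suc k ∸ 1) ∎
  where
  open ℕP.≤-Reasoning
  open +-*-Solver
  regroup : ∀ x y → (x * (x * y)) ^ 5 ≡ x ^ 10 * y ^ 5
  regroup = solve 2 (λ x y → (x :* (x :* y)) :^ 5 := x :^ 10 :* y :^ 5) refl
  exponent : k * 5 ≤ 5 * suc k ∸ 1
  exponent = subst (_≤ k + 4 * suc k) (ℕP.*-comm 5 k)
                   (ℕP.+-monoʳ-≤ k (ℕP.*-monoʳ-≤ 4 (ℕP.n≤1+n k)))

lemma3p12 : ∀ {c ℓ : Level} (G : AbelianGroup c ℓ) (n : ℕ) → HasOrder G n → 10 ^ 100 ≤ n →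
    (k : ℕ) → 1 ≤ k →
    (S : List (Word G k)) → AllPairs (λ w w' → ¬ (_≈W_ G w w')) S → length S ≤ 1000 →
    (ps : List (Projection G k)) → AllPairs (Distinct G) ps →
    All (λ p → ¬ Separates G (π p) S) ps →
    length ps ^ 5 ≤ length S ^ 10 * n ^ (5 * k ∸ 1)
lemma3p12 G n order n-large (suc k) _ S _ _ ps distinct unseparated =
  fifth-power-bound (length ps) (length S) n k (ℕP.≤-trans (ℕP.m^n>0 10 100) n-large)
    (length≤-by-code (λ {p} ¬p → code (catch p ¬p)) distinct⇒code≢ distinct unseparated)
  where
  open Counting G order S
  distinct⇒code≢ : ∀ {p q} (¬p : ¬ Separates G (π p) S) (¬q : ¬ Separates G (π q) S) →
                     Distinct G p q → code (catch p ¬p) ≢ code (catch q ¬q)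
  distinct⇒code≢ ¬p ¬q (w , p≉q) same = p≉q (code-determines (catch _ ¬p) (catch _ ¬q) same w)
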